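{- Let $\tau=(w,x)$ be a pair, $t\in R_\tau$, $p\in X^c_{\tau_t}$, and write $p^\downarrow_\tau=(i',j)$ and $p^\downarrow_{\tau_t}=(i'',j)$. Then $i''\ge i'$. In particular, if $p$ is $\downarrow$-maximal with respect to $\tau_t$ then it is also $\downarrow$-maximal with respect to $\tau$.
   Context: $S_n$ is the symmetric group on $\{1,\dots,n\}$ with Bruhat order $\le$; $\Box=\{0,\dots,n\}^2$. For $w\in S_n$, $\mathrm{rk}_w(i,j)=\#\{u\le i:w(u)\le j\}$ on $\Box$, and $D_w((i,j),(i',j'))=\mathrm{rk}_w(i,j)+\mathrm{rk}_w(i',j')-\mathrm{rk}_w(i,j')-\mathrm{rk}_w(i',j)$. A pair is $\sigma=(u,v)$ with $v\le u$; $\mathrm{rk}_\sigma=\mathrm{rk}_v-\mathrm{rk}_u$, $X_\sigma=\{p\in\Box:\mathrm{rk}_\sigma(p)=0\}$, $X^c_\sigma=\Box\setminus X_\sigma$. For $\tau=(w,x)$, $R_\tau=\{t\text{ transposition}:x<xt\le w\}$ and $\tau_t=(w,xt)$ for $t\in R_\tau$. For a pair $\sigma=(u,v)$ and $p=(i,j)\in\Box$ with $1\le j\le n-1$: $j^+=\min\{k>j:(i,k)\in X_\sigma\}$, $i^+=\max\{l\ge i:(l,j^+)\in X_\sigma,\ D_u(p,(l,j^+))=0\}$, $p^\downarrow_\sigma=(i^+,j)$; $p$ is $\downarrow$-maximal w.r.t. $\sigma$ if $p^\downarrow_\sigma=p$. -}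

module Defs where

open import Data.Nat using (ℕ; zero; suc; _+_; _∸_; _≤_; _<_; _<ᵇ_)
open import Data.Integer as ℤ using (ℤ; +_; _-_)
open import Data.Fin using (Fin; toℕ)
open import Data.Fin.Permutation using (Permutation′; _⟨$⟩ʳ_; _∘ₚ_; transpose)
open import Data.List using (List; map; allFin)
open import Data.Nat.ListAction using (sum)
open import Data.Bool using (Bool; true; false; if_then_else_; _∧_)
open import Data.Product using (∃; ∃₂; _×_; _,_)
open import Relation.Binary.PropositionalEquality using (_≡_; _≢_)
open import Relation.Nullary using (¬_; does)
open import Relation.Binary.Construct.Closure.ReflexiveTransitive using (Star)

-- Permutations of {1,…,n}, realised on Fin n = {0,…,n-1} (value k+1 ↔ index k).
Perm : ℕ → Set
Perm n = Permutation′ n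

_≈ₚ_ : ∀ {n} → Perm n → Perm n → Set
π ≈ₚ ρ = ∀ k → π ⟨$⟩ʳ k ≡ ρ ⟨$⟩ʳ k

-- Product x·t as functions: (x·t)(k) = x(t(k)).  (π ∘ₚ ρ applies π first.)
_·_ : ∀ {n} → Perm n → Perm n → Perm n
x · t = t ∘ₚ x

IsTransposition : ∀ {n} → Perm n → Set
IsTransposition {n} t = ∃₂ λ (a b : Fin n) → a ≢ b × (t ≈ₚ transpose a b)

-- Elementary Bruhat step: y = x·(a b) with a < b and x(a) < x(b)
-- (equivalently ℓ(x·(a b)) > ℓ(x)).
BruhatStep : ∀ {n} → Perm n → Perm n → Set
BruhatStep {n} x y =
  ∃₂ λ (a b : Fin n) → toℕ a < toℕ b × toℕ (x ⟨$⟩ʳ a) < toℕ (x ⟨$⟩ʳ b)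
     × (y ≈ₚ (x · transpose a b))

_≤B_ : ∀ {n} → Perm n → Perm n → Set
x ≤B y = ∃ λ x' → (x ≈ₚ x') × Star BruhatStep x' y

_<B_ : ∀ {n} → Perm n → Perm n → Set
x <B y = x ≤B y × ¬ (x ≈ₚ y)

-- rk_w(i,j) = #{u ≤ i : w(u) ≤ j} (1-based), i.e. #{u : toℕ u < i, toℕ (w u) < j}.
rk : ∀ {n} → Perm n → ℕ → ℕ → ℕ
rk {n} w i j =
  sum (map (λ u → if (toℕ u <ᵇ i) ∧ (toℕ (w ⟨$⟩ʳ u) <ᵇ j) then 1 else 0) (allFin n))

rkℤ : ∀ {n} → Perm n → ℕ → ℕ → ℤ
rkℤ w i j = + rk w i j

D : ∀ {n} → Perm n → (ℕ × ℕ) → (ℕ × ℕ) → ℤ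
D w (i , j) (i' , j') =
  ((rkℤ w i j ℤ.+ rkℤ w i' j') - rkℤ w i j') - rkℤ w i' j

-- A pair σ = (u , v) with v ≤ u; rk_σ = rk_v − rk_u.
rkσ : ∀ {n} → Perm n → Perm n → ℕ → ℕ → ℤ
rkσ u v i j = rkℤ v i j - rkℤ u i j

InX : ∀ {n} → Perm n → Perm n → (ℕ × ℕ) → Set
InX u v (i , j) = rkσ u v i j ≡ + 0

inXᵇ : ∀ {n} → Perm n → Perm n → ℕ → ℕ → Bool
inXᵇ u v i j = does (rkσ u v i j ℤ.≟ + 0)

firstFrom : (ℕ → Bool) → ℕ → ℕ → ℕ → ℕ
firstFrom P k fuel d with fuel
... | zero = d
... | suc f = if P k then k else firstFrom P (suc k) f d

lastDown : (ℕ → Bool) → ℕ → ℕ → ℕ → ℕ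
lastDown P l fuel d with fuel
... | zero = d
... | suc f = if P l then l else lastDown P (l ∸ 1) f d

-- j⁺ = min{k > j : (i,k) ∈ X_σ}  (k ranges over j+1,…,n; (i,n) ∈ X_σ always)
jPlus : ∀ {n} → Perm n → Perm n → ℕ → ℕ → ℕ
jPlus {n} u v i j = firstFrom (λ k → inXᵇ u v i k) (suc j) (n ∸ j) n

-- i⁺ = max{l ≥ i : (l,j⁺) ∈ X_σ, D_u(p,(l,j⁺)) = 0}  (l ranges over n, n-1, …, i)
iPlus : ∀ {n} → Perm n → Perm n → ℕ → ℕ → ℕ
iPlus {n} u v i j =
  lastDown (λ l → inXᵇ u v l jp ∧ does (D u (i , j) (l , jp) ℤ.≟ + 0))
           n (suc (n ∸ i)) i
  where jp = jPlus u v i j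

down : ∀ {n} → Perm n → Perm n → (ℕ × ℕ) → ℕ × ℕ
down u v (i , j) = (iPlus u v i j , j)

-- Write v = x·t, so x ≤ v ≤ w.  Everything rests on two facts about rank
-- functions rk_w(i,j) = #{u < i : w(u) < j}:
--   * antitonicity: x ≤ y in Bruhat order implies rk_y ≤ rk_x pointwise.
--     A Bruhat step x ↦ x·(a b) exchanges the values of a pair that x
--     orders consistently; summing the effect over all pairs {u , (a b)(u)}
--     counts each rank twice and gives the claim;
--   * the Monge inequality D_w((i,j),(l,k)) ≥ 0 for i ≤ l, j ≤ k, since
--     each point of the permutation contributes a nonnegative amount.  In the module Sandwich (rk_w ≤ rk_v ≤ rk_x) we get X_τ ⊆ X_{τ_t},
-- hence j⁺ for τ_t is at most j⁺ for τ; by the Monge inequality every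
-- candidate row for i⁺ with respect to τ is one for τ_t, so i⁺ can only grow.
-- The lemma follows.
module Submission where

open import Defs
open import Data.Nat using (ℕ; zero; suc; _+_; _∸_; _≤_; _<_; _<ᵇ_; z≤n; s≤s; z<s)
open import Data.Nat.Properties
open import Data.Nat.Tactic.RingSolver using (solve-∀)
import Data.Nat.ListAction as List
open import Data.Integer as ℤ using (ℤ; +_)
import Data.Integer.Properties as ℤ
open import Data.Bool using (Bool; true; false; if_then_else_; _∧_; T)
open import Data.Bool.Properties using (T-≡; ∧-identityʳ)
open import Data.Fin as Fin using (Fin; toℕ)
open import Data.Fin.Properties using (toℕ<n) renaming (_≟_ to _≟ᶠ_)
import Data.Fin.Permutation.Components as Components
open import Data.Fin.Permutation using (_⟨$⟩ʳ_; transpose)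
open import Data.List using (tabulate)
open import Data.List.Properties using (map-tabulate)
open import Algebra.Properties.CommutativeMonoid.Sum +-0-commutativeMonoid
  using (∑-distrib-+; sum-permute; sum-cong-≗) renaming (sum to ∑)
open import Data.Product using (_×_; _,_; proj₁; proj₂)
open import Data.Sum using (_⊎_; inj₁; inj₂)
open import Function using (_∘_; id; _⇔_; mk⇔; Equivalence; case_of_)
open import Relation.Binary.PropositionalEquality
open import Relation.Binary.Construct.Closure.ReflexiveTransitive using (Star; ε; _◅_)
open import Relation.Nullary using (¬_; does; yes; no; contradiction)
open import Relation.Nullary.Decidable using (dec-true; dec-false)

open Equivalence using (to; from)

firstFrom-spec : ∀ P k fuel d →
  firstFrom P k fuel d ≡ d
  ⊎ (P (firstFrom P k fuel d) ≡ true × k ≤ firstFrom P k fuel d × firstFrom P k fuel d < k + fuel)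
firstFrom-spec P k zero d = inj₁ refl
firstFrom-spec P k (suc fuel) d with P k in hit
... | true = inj₂ (hit , ≤-refl , m<m+n k z<s)
... | false with firstFrom-spec P (suc k) fuel d
...   | inj₁ default = inj₁ default
...   | inj₂ (found , k<r , r<end) =
        inj₂ (found , <⇒≤ k<r , subst (firstFrom P (suc k) fuel d <_) (sym (+-suc k fuel)) r<end)

firstFrom-minimal : ∀ P k fuel d m → P m ≡ true → k ≤ m → m < k + fuel →
  firstFrom P k fuel d ≤ m
firstFrom-minimal P k zero d m _ k≤m m<k+0 =
  contradiction (≤-trans m<k+0 (≤-reflexive (+-identityʳ k))) (≤⇒≯ k≤m)
firstFrom-minimal P k (suc fuel) d m Pm k≤m m<end with P k in miss
... | true = k≤m
... | false = firstFrom-minimal P (suc k) fuel d m Pm (≤∧≢⇒< k≤m k≢m)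
                (subst (m <_) (+-suc k fuel) m<end)
  where
  k≢m : k ≢ m
  k≢m refl = case trans (sym miss) Pm of λ ()

lastDown-spec : ∀ P l fuel d →
  lastDown P l fuel d ≡ d
  ⊎ (P (lastDown P l fuel d) ≡ true × lastDown P l fuel d ≤ l × l < lastDown P l fuel d + fuel)
lastDown-spec P l zero d = inj₁ refl
lastDown-spec P l (suc fuel) d with P l in hit
... | true = inj₂ (hit , ≤-refl , m<m+n l z<s)
... | false with lastDown-spec P (l ∸ 1) fuel d
...   | inj₁ default = inj₁ default
...   | inj₂ (found , r≤l-1 , l-1<end) = inj₂ (found , ≤-trans r≤l-1 (m∸n≤m l 1) , window l-1<end)
  where
  window : ∀ {r} → l ∸ 1 < r + fuel → l < r + suc fuel
  window {r} lt = subst (l <_) (sym (+-suc r fuel)) (s≤s (≤-trans (m≤n+m∸n l 1) lt))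

lastDown-maximal : ∀ P l fuel d m → P m ≡ true → m ≤ l → l < m + fuel →
  m ≤ lastDown P l fuel d
lastDown-maximal P l zero d m _ m≤l l<m+0 =
  contradiction (≤-trans l<m+0 (≤-reflexive (+-identityʳ m))) (≤⇒≯ m≤l)
lastDown-maximal P l (suc fuel) d m Pm m≤l l<end with P l in miss
... | true = m≤l
... | false = lastDown-maximal P (l ∸ 1) fuel d m Pm (∸-monoˡ-≤ 1 m<l) l-1<end
  where
  m<l : m < l
  m<l = ≤∧≢⇒< m≤l λ { refl → case trans (sym miss) Pm of λ () }
  l-1<end : l ∸ 1 < m + fuel
  l-1<end = <-≤-trans (pred-below m<l) (≤-pred (subst (l <_) (+-suc m fuel) l<end))
    where
    pred-below : ∀ {a b} → a < b → b ∸ 1 < b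
    pred-below (s≤s _) = ≤-refl

-- j⁺ scans the columns j+1, …, n; their window ends at n + 1.
upward-window-end : ∀ {j n} → j ≤ n → suc j + (n ∸ j) ≡ suc n
upward-window-end j≤n = cong suc (m+[n∸m]≡n j≤n)

-- i⁺ scans the rows n, n−1, …, i; a row m ≤ n lies in this window iff i ≤ m.
downward-window : ∀ {i n} → i ≤ n → ∀ m → i ≤ m ⇔ n < m + suc (n ∸ i)
downward-window {i} {n} i≤n m = mk⇔ inside below
  where
  inside : i ≤ m → n < m + suc (n ∸ i)
  inside i≤m = begin-strict
    n               ≡⟨ m+[n∸m]≡n i≤n ⟨
    i + (n ∸ i)     ≤⟨ +-monoˡ-≤ (n ∸ i) i≤m ⟩
    m + (n ∸ i)     <⟨ n<1+n _ ⟩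
    suc (m + (n ∸ i)) ≡⟨ +-suc m (n ∸ i) ⟨
    m + suc (n ∸ i) ∎
    where open ≤-Reasoning
  below : n < m + suc (n ∸ i) → i ≤ m
  below n<end = +-cancelʳ-≤ (n ∸ i) i m (begin
    i + (n ∸ i) ≡⟨ m+[n∸m]≡n i≤n ⟩
    n           ≤⟨ ≤-pred (subst (n <_) (+-suc m (n ∸ i)) n<end) ⟩
    m + (n ∸ i) ∎)
    where open ≤-Reasoning

downward-search-bounds : ∀ P {i n} → i ≤ n →
  i ≤ lastDown P n (suc (n ∸ i)) i × lastDown P n (suc (n ∸ i)) i ≤ n
downward-search-bounds P {i} {n} i≤n with lastDown-spec P n (suc (n ∸ i)) i
... | inj₁ default = subst (λ r → i ≤ r × r ≤ n) (sym default) (≤-refl , i≤n)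
... | inj₂ (_ , r≤n , n<end) = from (downward-window i≤n _) n<end , r≤n

ind : Bool → ℕ
ind b = if b then 1 else 0

ind-mono : ∀ {b b'} → (T b → T b') → ind b ≤ ind b'
ind-mono {false} _ = z≤n
ind-mono {true} {true} _ = ≤-refl
ind-mono {true} {false} b⇒b' = contradiction (b⇒b' _) λ ()

indicator-monge : ∀ A A' B B' → (T A' → T A) → (T B' → T B) →
  ind (A ∧ B') + ind (A' ∧ B) ≤ ind (A ∧ B) + ind (A' ∧ B')
indicator-monge false false B B' _ _ = z≤n
indicator-monge false true B B' A'⇒A _ = contradiction (A'⇒A _) λ ()
indicator-monge true false B B' _ B'⇒B = +-monoˡ-≤ 0 (ind-mono B'⇒B)
indicator-monge true true B B' _ _ = ≤-reflexive (+-comm (ind B') (ind B))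

inQuadrant : ℕ → ℕ → ℕ → ℕ → ℕ
inQuadrant i j a b = ind ((a <ᵇ i) ∧ (b <ᵇ j))

<ᵇ-mono : ∀ {a a' i i'} → a ≤ a' → i' ≤ i → T (a' <ᵇ i') → T (a <ᵇ i)
<ᵇ-mono {a} {a'} {i} {i'} a≤a' i'≤i lt =
  <⇒<ᵇ (≤-trans (s≤s a≤a') (≤-trans (<ᵇ⇒< a' i' lt) i'≤i))

quadrant-monge : ∀ {i i' j j'} → i ≤ i' → j ≤ j' → ∀ a b →
  inQuadrant i' j a b + inQuadrant i j' a b ≤ inQuadrant i' j' a b + inQuadrant i j a b
quadrant-monge {i} {i'} {j} {j'} i≤i' j≤j' a b =
  indicator-monge (a <ᵇ i') (a <ᵇ i) (b <ᵇ j') (b <ᵇ j)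
    (<ᵇ-mono ≤-refl i≤i') (<ᵇ-mono ≤-refl j≤j')

point-monge : ∀ {p q r s} → p ≤ q → r ≤ s → ∀ i j →
  inQuadrant i j p s + inQuadrant i j q r ≤ inQuadrant i j p r + inQuadrant i j q s
point-monge {p} {q} {r} {s} p≤q r≤s i j =
  indicator-monge (p <ᵇ i) (q <ᵇ i) (r <ᵇ j) (s <ᵇ j)
    (<ᵇ-mono {i = i} p≤q ≤-refl) (<ᵇ-mono {i = j} r≤s ≤-refl)

χ : ∀ {n} → Perm n → ℕ → ℕ → Fin n → ℕ
χ w i j u = inQuadrant i j (toℕ u) (toℕ (w ⟨$⟩ʳ u))

-- rk is defined as a list sum; we reason with the vector sum ∑ of the library.
list-sum-tabulate : ∀ {n} (f : Fin n → ℕ) → List.sum (tabulate f) ≡ ∑ f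
list-sum-tabulate {zero} f = refl
list-sum-tabulate {suc n} f = cong (_+_ (f Fin.zero)) (list-sum-tabulate (f ∘ Fin.suc))

rk-as-∑ : ∀ {n} (w : Perm n) i j → rk w i j ≡ ∑ (χ w i j)
rk-as-∑ w i j = trans (cong List.sum (map-tabulate id (χ w i j))) (list-sum-tabulate (χ w i j))

rank-pair-as-∑ : ∀ {n} (w : Perm n) i j i' j' →
  rk w i j + rk w i' j' ≡ ∑ (λ u → χ w i j u + χ w i' j' u)
rank-pair-as-∑ w i j i' j' =
  trans (cong₂ _+_ (rk-as-∑ w i j) (rk-as-∑ w i' j')) (sym (∑-distrib-+ (χ w i j) (χ w i' j')))

∑-mono : ∀ {n} {f g : Fin n → ℕ} → (∀ u → f u ≤ g u) → ∑ f ≤ ∑ g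
∑-mono {zero} _ = z≤n
∑-mono {suc n} f≤g = +-mono-≤ (f≤g Fin.zero) (∑-mono (f≤g ∘ Fin.suc))

rank-cong : ∀ {n} {x y : Perm n} → x ≈ₚ y → ∀ i j → rk x i j ≡ rk y i j
rank-cong {x = x} {y} x≈y i j = begin
  rk x i j     ≡⟨ rk-as-∑ x i j ⟩
  ∑ (χ x i j)  ≡⟨ sum-cong-≗ (λ u → cong (inQuadrant i j (toℕ u) ∘ toℕ) (x≈y u)) ⟩
  ∑ (χ y i j)  ≡⟨ rk-as-∑ y i j ⟨
  rk y i j     ∎
  where open ≡-Reasoning

-- Column n contains every point, so rk(i,n) is the same for all permutations;
-- in particular (i , n) lies in every X_σ.
rank-last-column : ∀ {n} (x y : Perm n) i → rk x i n ≡ rk y i n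
rank-last-column {n} x y i = begin
  rk x i n     ≡⟨ rk-as-∑ x i n ⟩
  ∑ (χ x i n)  ≡⟨ sum-cong-≗ (λ u → trans (row u x) (sym (row u y))) ⟩
  ∑ (χ y i n)  ≡⟨ rk-as-∑ y i n ⟨
  rk y i n     ∎
  where
  open ≡-Reasoning
  row : ∀ u (z : Perm n) → χ z i n u ≡ ind (toℕ u <ᵇ i)
  row u z = trans (cong (λ b → ind ((toℕ u <ᵇ i) ∧ b)) (to T-≡ (<⇒<ᵇ (toℕ<n (z ⟨$⟩ʳ u)))))
                  (cong ind (∧-identityʳ (toℕ u <ᵇ i)))

rank-monge : ∀ {n} (w : Perm n) {i l k K} → i ≤ l → k ≤ K →
  rk w l k + rk w i K ≤ rk w l K + rk w i k
rank-monge w {i} {l} {k} {K} i≤l k≤K = begin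
  rk w l k + rk w i K                 ≡⟨ rank-pair-as-∑ w l k i K ⟩
  ∑ (λ u → χ w l k u + χ w i K u)     ≤⟨ ∑-mono (λ u → quadrant-monge i≤l k≤K (toℕ u) (toℕ (w ⟨$⟩ʳ u))) ⟩
  ∑ (λ u → χ w l K u + χ w i k u)     ≡⟨ rank-pair-as-∑ w l K i k ⟨
  rk w l K + rk w i k                 ∎
  where open ≤-Reasoning

Coordered : ∀ {n} → Perm n → Fin n → Fin n → Set
Coordered x u s = (toℕ u ≤ toℕ s × toℕ (x ⟨$⟩ʳ u) ≤ toℕ (x ⟨$⟩ʳ s))
                ⊎ (toℕ s ≤ toℕ u × toℕ (x ⟨$⟩ʳ s) ≤ toℕ (x ⟨$⟩ʳ u))

exchange-lowers : ∀ {n} (x : Perm n) {u s} → Coordered x u s → ∀ i j →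
  inQuadrant i j (toℕ u) (toℕ (x ⟨$⟩ʳ s)) + inQuadrant i j (toℕ s) (toℕ (x ⟨$⟩ʳ u))
  ≤ χ x i j u + χ x i j s
exchange-lowers x (inj₁ (u≤s , xu≤xs)) i j = point-monge u≤s xu≤xs i j
exchange-lowers x {u} {s} (inj₂ (s≤u , xs≤xu)) i j =
  subst₂ _≤_ (+-comm (inQuadrant i j (toℕ s) (toℕ (x ⟨$⟩ʳ u))) (inQuadrant i j (toℕ u) (toℕ (x ⟨$⟩ʳ s))))
             (+-comm (χ x i j s) (χ x i j u)) (point-monge s≤u xs≤xu i j)

double-cancel : ∀ {m n} → m + m ≤ n + n → m ≤ n
double-cancel m+m≤n+n = ≮⇒≥ λ n<m → <⇒≱ (+-mono-< n<m n<m) m+m≤n+n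

-- Composing x with an involution that only exchanges co-ordered pairs lowers
-- every rank: summing the exchange inequality over u and over τ(u) counts
-- each rank twice.
rank-exchange : ∀ {n} (x y τ : Perm n) → (∀ u → τ ⟨$⟩ʳ (τ ⟨$⟩ʳ u) ≡ u) →
  y ≈ₚ (x · τ) → (∀ u → Coordered x u (τ ⟨$⟩ʳ u)) → ∀ i j → rk y i j ≤ rk x i j
rank-exchange x y τ involutive y≈xτ coordered i j = double-cancel (begin
  rk y i j + rk y i j                       ≡⟨ twice y ⟩
  ∑ (λ u → χ y i j u + χ y i j (τ ⟨$⟩ʳ u))  ≤⟨ ∑-mono pair ⟩
  ∑ (λ u → χ x i j u + χ x i j (τ ⟨$⟩ʳ u))  ≡⟨ twice x ⟨
  rk x i j + rk x i j                       ∎)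
  where
  open ≤-Reasoning
  twice : ∀ z → rk z i j + rk z i j ≡ ∑ (λ u → χ z i j u + χ z i j (τ ⟨$⟩ʳ u))
  twice z = trans (cong₂ _+_ (rk-as-∑ z i j) (trans (rk-as-∑ z i j) (sum-permute (χ z i j) τ)))
                  (sym (∑-distrib-+ (χ z i j) (χ z i j ∘ (τ ⟨$⟩ʳ_))))
  y-at : ∀ u → χ y i j u ≡ inQuadrant i j (toℕ u) (toℕ (x ⟨$⟩ʳ (τ ⟨$⟩ʳ u)))
  y-at u = cong (inQuadrant i j (toℕ u) ∘ toℕ) (y≈xτ u)
  y-at-partner : ∀ u → χ y i j (τ ⟨$⟩ʳ u) ≡ inQuadrant i j (toℕ (τ ⟨$⟩ʳ u)) (toℕ (x ⟨$⟩ʳ u))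
  y-at-partner u = trans (y-at (τ ⟨$⟩ʳ u))
    (cong (inQuadrant i j (toℕ (τ ⟨$⟩ʳ u)) ∘ toℕ ∘ (x ⟨$⟩ʳ_)) (involutive u))
  pair : ∀ u → χ y i j u + χ y i j (τ ⟨$⟩ʳ u) ≤ χ x i j u + χ x i j (τ ⟨$⟩ʳ u)
  pair u = subst (_≤ χ x i j u + χ x i j (τ ⟨$⟩ʳ u)) (sym (cong₂ _+_ (y-at u) (y-at-partner u)))
                 (exchange-lowers x (coordered u) i j)

data Position {n} (a b : Fin n) : Fin n → Set where
  at-left   : Position a b a
  at-right  : Position a b b
  elsewhere : ∀ {u} → u ≢ a → u ≢ b → Position a b u

position : ∀ {n} (a b u : Fin n) → Position a b u
position a b u with u ≟ᶠ a | u ≟ᶠ b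
... | yes refl | _        = at-left
... | no _     | yes refl = at-right
... | no u≢a   | no u≢b   = elsewhere u≢a u≢b

transpose-left : ∀ {n} (a b : Fin n) → Components.transpose a b a ≡ b
transpose-left a b rewrite dec-true (a ≟ᶠ a) refl = refl

transpose-right : ∀ {n} (a b : Fin n) → Components.transpose a b b ≡ a
transpose-right a b with b ≟ᶠ a
... | yes b≡a = b≡a
... | no _ rewrite dec-true (b ≟ᶠ b) refl = refl

transpose-elsewhere : ∀ {n} {a b u : Fin n} → u ≢ a → u ≢ b → Components.transpose a b u ≡ u
transpose-elsewhere {a = a} {b} {u} u≢a u≢b
  rewrite dec-false (u ≟ᶠ a) u≢a | dec-false (u ≟ᶠ b) u≢b = refl

transpose-involutive : ∀ {n} (a b : Fin n) u →
  transpose a b ⟨$⟩ʳ (transpose a b ⟨$⟩ʳ u) ≡ u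
transpose-involutive a b u = involutive (position a b u)
  where
  τ = Components.transpose a b
  involutive : ∀ {u} → Position a b u → τ (τ u) ≡ u
  involutive at-left  = trans (cong τ (transpose-left a b)) (transpose-right a b)
  involutive at-right = trans (cong τ (transpose-right a b)) (transpose-left a b)
  involutive (elsewhere u≢a u≢b) =
    trans (cong τ (transpose-elsewhere u≢a u≢b)) (transpose-elsewhere u≢a u≢b)

transposition-coordered : ∀ {n} (x : Perm n) {a b} → toℕ a < toℕ b →
  toℕ (x ⟨$⟩ʳ a) < toℕ (x ⟨$⟩ʳ b) → ∀ u → Coordered x u (transpose a b ⟨$⟩ʳ u)
transposition-coordered x {a} {b} a<b xa<xb u with position a b u
... | at-left  = subst (Coordered x a) (sym (transpose-left a b)) (inj₁ (<⇒≤ a<b , <⇒≤ xa<xb))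
... | at-right = subst (Coordered x b) (sym (transpose-right a b)) (inj₂ (<⇒≤ a<b , <⇒≤ xa<xb))
... | elsewhere u≢a u≢b =
  subst (Coordered x u) (sym (transpose-elsewhere u≢a u≢b)) (inj₁ (≤-refl , ≤-refl))

rank-step : ∀ {n} {x y : Perm n} → BruhatStep x y → ∀ i j → rk y i j ≤ rk x i j
rank-step {x = x} {y} (a , b , a<b , xa<xb , y≈xt) =
  rank-exchange x y (transpose a b) (transpose-involutive a b) y≈xt
    (transposition-coordered x a<b xa<xb)

rank-antitone : ∀ {n} {x y : Perm n} → x ≤B y → ∀ i j → rk y i j ≤ rk x i j
rank-antitone {x = x} {y} (x' , x≈x' , steps) i j =
  subst (rk y i j ≤_) (sym (rank-cong {x = x} {x'} x≈x' i j)) (along steps)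
  where
  along : ∀ {z} → Star BruhatStep z y → rk y i j ≤ rk z i j
  along ε = ≤-refl
  along {z} (_◅_ {j = z'} step steps) = ≤-trans (along steps) (rank-step {x = z} {z'} step i j)

zero-test : (z : ℤ) → does (z ℤ.≟ + 0) ≡ true ⇔ z ≡ + 0
zero-test z = mk⇔ sound (dec-true (z ℤ.≟ + 0))
  where
  sound : does (z ℤ.≟ + 0) ≡ true → z ≡ + 0
  sound _ with z ℤ.≟ + 0
  sound _  | yes z≡0 = z≡0
  sound () | no _

difference-zero : ∀ m n → (+ m ℤ.- + n ≡ + 0) ⇔ (m ≡ n)
difference-zero m n =
  mk⇔ (ℤ.+-injective ∘ ℤ.i-j≡0⇒i≡j (+ m) (+ n)) (ℤ.i≡j⇒i-j≡0 ∘ cong (λ k → + k))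

inX-test : ∀ {n} (u v : Perm n) i j → inXᵇ u v i j ≡ true ⇔ rk v i j ≡ rk u i j
inX-test u v i j = mk⇔ (to diff ∘ to zt) (from zt ∘ from diff)
  where
  zt = zero-test (rkσ u v i j)
  diff = difference-zero (rk v i j) (rk u i j)

D-as-difference : ∀ {n} (w : Perm n) i j l k →
  D w (i , j) (l , k) ≡ + (rk w i j + rk w l k) ℤ.- + (rk w i k + rk w l j)
D-as-difference w i j l k = begin
  (+ (rk w i j + rk w l k) ℤ.- + rk w i k) ℤ.- + rk w l j
    ≡⟨ ℤ.+-assoc (+ (rk w i j + rk w l k)) (ℤ.- + rk w i k) (ℤ.- + rk w l j) ⟩
  + (rk w i j + rk w l k) ℤ.+ (ℤ.- + rk w i k ℤ.- + rk w l j)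
    ≡⟨ cong (ℤ._+_ (+ (rk w i j + rk w l k))) (ℤ.neg-distrib-+ (+ rk w i k) (+ rk w l j)) ⟨
  + (rk w i j + rk w l k) ℤ.- + (rk w i k + rk w l j) ∎
  where open ≡-Reasoning

D-test : ∀ {n} (w : Perm n) i j l k →
  does (D w (i , j) (l , k) ℤ.≟ + 0) ≡ true ⇔ rk w i j + rk w l k ≡ rk w i k + rk w l j
D-test w i j l k = mk⇔ (to diff ∘ subst (_≡ + 0) (D-as-difference w i j l k) ∘ to zt)
                       (from zt ∘ subst (_≡ + 0) (sym (D-as-difference w i j l k)) ∘ from diff)
  where
  zt = zero-test (D w (i , j) (l , k))
  diff = difference-zero (rk w i j + rk w l k) (rk w i k + rk w l j)

∧-true : ∀ {a b} → (a ∧ b) ≡ true ⇔ (a ≡ true × b ≡ true)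
∧-true {true} = mk⇔ (refl ,_) proj₂
∧-true {false} = mk⇔ (λ ()) (λ { (() , _) })

jPlus-spec : ∀ {n} (u v : Perm n) i {j} → j < n →
  suc j ≤ jPlus u v i j × jPlus u v i j ≤ n × rk v i (jPlus u v i j) ≡ rk u i (jPlus u v i j)
jPlus-spec {n} u v i {j} j<n with firstFrom-spec (inXᵇ u v i) (suc j) (n ∸ j) n
... | inj₁ default = subst (λ K → suc j ≤ K × K ≤ n × rk v i K ≡ rk u i K) (sym default)
                       (j<n , ≤-refl , rank-last-column v u i)
... | inj₂ (found , j<K , K<end) =
  j<K , ≤-pred (subst (jPlus u v i j <_) (upward-window-end (<⇒≤ j<n)) K<end)
      , to (inX-test u v i (jPlus u v i j)) found

jPlus-minimal : ∀ {n} (u v : Perm n) i {j m} → j ≤ n → suc j ≤ m → m ≤ n →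
  rk v i m ≡ rk u i m → jPlus u v i j ≤ m
jPlus-minimal {n} u v i {j} {m} j≤n j<m m≤n m∈X =
  firstFrom-minimal (inXᵇ u v i) (suc j) (n ∸ j) n m (from (inX-test u v i m) m∈X) j<m
    (subst (m <_) (sym (upward-window-end j≤n)) (s≤s m≤n))

Candidate : ∀ {n} → Perm n → Perm n → ℕ → ℕ → ℕ → Set
Candidate u v i j l = rk v l K ≡ rk u l K × rk u i j + rk u l K ≡ rk u i K + rk u l j
  where K = jPlus u v i j

candidateᵇ : ∀ {n} → Perm n → Perm n → ℕ → ℕ → ℕ → Bool
candidateᵇ u v i j l = inXᵇ u v l K ∧ does (D u (i , j) (l , K) ℤ.≟ + 0)
  where K = jPlus u v i j

candidate-test : ∀ {n} (u v : Perm n) i j l → candidateᵇ u v i j l ≡ true ⇔ Candidate u v i j l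
candidate-test u v i j l =
  mk⇔ (λ t → let (inX , D0) = to ∧-true t in to (inX-test u v l K) inX , to (D-test u i j l K) D0)
      (λ (inX , D0) → from ∧-true (from (inX-test u v l K) inX , from (D-test u i j l K) D0))
  where K = jPlus u v i j

iPlus-bounds : ∀ {n} (u v : Perm n) {i} j → i ≤ n → i ≤ iPlus u v i j × iPlus u v i j ≤ n
iPlus-bounds u v {i} j = downward-search-bounds (candidateᵇ u v i j)

iPlus-candidate : ∀ {n} (u v : Perm n) i j → iPlus u v i j ≡ i ⊎ Candidate u v i j (iPlus u v i j)
iPlus-candidate {n} u v i j with lastDown-spec (candidateᵇ u v i j) n (suc (n ∸ i)) i
... | inj₁ default = inj₁ default
... | inj₂ (found , _) = inj₂ (to (candidate-test u v i j (iPlus u v i j)) found)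

iPlus-maximal : ∀ {n} (u v : Perm n) {i} j {l} → i ≤ n → i ≤ l → l ≤ n →
  Candidate u v i j l → l ≤ iPlus u v i j
iPlus-maximal {n} u v {i} j {l} i≤n i≤l l≤n candidate =
  lastDown-maximal (candidateᵇ u v i j) n (suc (n ∸ i)) i l
    (from (candidate-test u v i j l) candidate) l≤n (to (downward-window i≤n l) i≤l)

tight-sum : ∀ {x₁ y₁ x₂ y₂} → x₁ ≤ y₁ → x₂ ≤ y₂ → y₁ + y₂ ≡ x₁ + x₂ → x₁ ≡ y₁ × x₂ ≡ y₂
tight-sum {x₁} {y₁} {x₂} {y₂} x₁≤y₁ x₂≤y₂ sums =
  ≤-antisym x₁≤y₁ (+-cancelʳ-≤ x₂ y₁ x₁ (≤-trans (+-monoʳ-≤ y₁ x₂≤y₂) (≤-reflexive sums))) ,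
  ≤-antisym x₂≤y₂ (+-cancelˡ-≤ x₁ y₂ x₂ (≤-trans (+-monoˡ-≤ y₂ x₁≤y₁) (≤-reflexive sums)))

-- For rk_w ≤ rk_v: if (i , k) and (l , K) lie in X_(w , v) with i ≤ l and
-- j ≤ k ≤ K, and D_w((i,j),(l,K)) = 0, then (l , k) lies in X_(w , v) and
-- D_w((i,j),(l,k)) = 0.  Indeed D_w((i,j),(l,K)) splits into the two
-- nonnegative Monge defects D_w((i,j),(l,k)) and D_w((i,k),(l,K)).
candidate-shift : ∀ {n} (w v : Perm n) → (∀ a b → rk w a b ≤ rk v a b) →
  ∀ {i l j k K} → i ≤ l → j ≤ k → k ≤ K →
  rk v i k ≡ rk w i k → rk v l K ≡ rk w l K →
  rk w i j + rk w l K ≡ rk w i K + rk w l j →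
  rk v l k ≡ rk w l k × rk w i j + rk w l k ≡ rk w i k + rk w l j
candidate-shift w v w≤v {i} {l} {j} {k} {K} i≤l j≤k k≤K ik∈X lK∈X D-zero =
  ≤-antisym lk-bound (w≤v l k) , D-left-zero
  where
  a = rk w i j; b = rk w i k; c = rk w i K
  d = rk w l j; e = rk w l k; f = rk w l K
  shuffle₁ : ∀ a b e f → (e + a) + (f + b) ≡ (a + f) + (e + b)
  shuffle₁ = solve-∀
  shuffle₂ : ∀ b c d e → (c + d) + (e + b) ≡ (d + b) + (e + c)
  shuffle₂ = solve-∀
  defects-sum : (e + a) + (f + b) ≡ (d + b) + (e + c)
  defects-sum = begin
    (e + a) + (f + b) ≡⟨ shuffle₁ a b e f ⟩
    (a + f) + (e + b) ≡⟨ cong (_+ (e + b)) D-zero ⟩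
    (c + d) + (e + b) ≡⟨ shuffle₂ b c d e ⟩
    (d + b) + (e + c) ∎
    where open ≡-Reasoning
  both-tight : d + b ≡ e + a × e + c ≡ f + b
  both-tight = tight-sum (rank-monge w i≤l j≤k) (rank-monge w i≤l k≤K) defects-sum
  D-left-zero : a + e ≡ b + d
  D-left-zero = trans (+-comm a e) (trans (sym (proj₁ both-tight)) (+-comm d b))
  lk-bound : rk v l k ≤ e
  lk-bound = +-cancelʳ-≤ (rk v i K) (rk v l k) e (begin
    rk v l k + rk v i K ≤⟨ rank-monge v i≤l k≤K ⟩
    rk v l K + rk v i k ≡⟨ cong₂ _+_ lK∈X ik∈X ⟩
    f + b               ≡⟨ proj₂ both-tight ⟨
    e + c               ≤⟨ +-monoʳ-≤ e (w≤v i K) ⟩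
    e + rk v i K        ∎)
    where open ≤-Reasoning

-- The setting of the lemma: rk_w ≤ rk_v ≤ rk_x pointwise, as for x ≤ v ≤ w
-- in Bruhat order.
module Sandwich {n} (w v x : Perm n)
  (lower : ∀ a b → rk w a b ≤ rk v a b) (upper : ∀ a b → rk v a b ≤ rk x a b) where

  X-inclusion : ∀ a b → rk x a b ≡ rk w a b → rk v a b ≡ rk w a b
  X-inclusion a b ab∈X = ≤-antisym (subst (rk v a b ≤_) ab∈X (upper a b)) (lower a b)

  jPlus-shrinks : ∀ i {j} → j < n → jPlus w v i j ≤ jPlus w x i j
  jPlus-shrinks i {j} j<n with jPlus-spec w x i j<n
  ... | j<K , K≤n , K∈X =
    jPlus-minimal w v i (<⇒≤ j<n) j<K K≤n (X-inclusion i (jPlus w x i j) K∈X)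

  candidate-transfer : ∀ {i j l} → j < n → i ≤ l → Candidate w x i j l → Candidate w v i j l
  candidate-transfer {i} {j} {l} j<n i≤l (lK∈X , D-zero) with jPlus-spec w v i j<n
  ... | j<k , _ , ik∈X =
    candidate-shift w v lower i≤l (<⇒≤ j<k) (jPlus-shrinks i j<n) ik∈X
      (X-inclusion l (jPlus w x i j) lK∈X) D-zero

  iPlus-grows : ∀ {i j} → i ≤ n → j < n → iPlus w x i j ≤ iPlus w v i j
  iPlus-grows {i} {j} i≤n j<n with iPlus-candidate w x i j
  ... | inj₁ i'≡i = subst (_≤ iPlus w v i j) (sym i'≡i) (proj₁ (iPlus-bounds w v j i≤n))
  ... | inj₂ candidate =
    let (i≤i' , i'≤n) = iPlus-bounds w x j i≤n
    in iPlus-maximal w v j i≤n i≤i' i'≤n (candidate-transfer j<n i≤i' candidate)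

inner-column : ∀ {j} n → 1 ≤ j → j ≤ n ∸ 1 → j < n
inner-column {suc _} zero _ ()
inner-column (suc n) _ j≤n = s≤s j≤n

lemma4p7 : ∀ (n : ℕ) (w x t : Perm n) →
    x ≤B w →
    IsTransposition t → x <B (x · t) → (x · t) ≤B w →
    ∀ (i j : ℕ) → i ≤ n → 1 ≤ j → j ≤ n ∸ 1 →
    ¬ InX w (x · t) (i , j) →
    (proj₁ (down w x (i , j)) ≤ proj₁ (down w (x · t) (i , j)))
    × (down w (x · t) (i , j) ≡ (i , j) → down w x (i , j) ≡ (i , j))
lemma4p7 n w x t _ _ (x≤v , _) v≤w i j i≤n 1≤j j≤n-1 _ = i'≤i'' , maximal-transfers
  where
  i'≤i'' : iPlus w x i j ≤ iPlus w (x · t) i j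
  i'≤i'' = Sandwich.iPlus-grows w (x · t) x (rank-antitone {x = x · t} {w} v≤w)
             (rank-antitone {x = x} {x · t} x≤v) i≤n (inner-column n 1≤j j≤n-1)
  maximal-transfers : down w (x · t) (i , j) ≡ (i , j) → down w x (i , j) ≡ (i , j)
  maximal-transfers i''≡i = cong (_, j)
    (≤-antisym (subst (iPlus w x i j ≤_) (cong proj₁ i''≡i) i'≤i'') (proj₁ (iPlus-bounds w x j i≤n)))
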